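{- Let $G$ be a graph of order $n$ such that either $G$ is a complete multipartite graph, or there are positive integers $a\le b$ and a partition $V(G)=A\cup B$ with $|A|=a$, $|B|=b$, $B$ independent, and every vertex of $A$ adjacent to every vertex of $B$ (i.e. $K_{a,b}\le G\le K_a+E_b$). Then the following are equivalent: (i) $\alpha(G)\leq\lceil n/2\rceil$; (ii) $G$ has a perfect matching or a near-perfect matching; (iii) $G$ is traceable; (iv) $G$ is arbitrarily partitionable; (v) $G$ is recursively partitionable.
   Context: $\alpha(G)$ is the independence number; $E_b$ is the edgeless graph on $b$ vertices; $K_a+E_b$ is the join. A near-perfect matching is a set of pairwise disjoint edges covering all vertices but one. Traceable means having a Hamiltonian path. A graph $G$ on $n$ vertices is arbitrarily partitionable (AP) if for every integer partition $a_1,\dots,a_m$ of $n$ there is a partition $\{A_1,\dots,A_m\}$ of $V(G)$ with $|A_i|=a_i$ and each $G[A_i]$ connected. $G$ is recursively partitionable (RP) if $G\simeq K_1$, or $G$ is connected and for every integer partition $a_1,\dots,a_m$ of $n$ there is such a partition with each induced subgraph $G[A_i]$ RP. -}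

module Defs where

open import Data.Bool using (Bool; true; false)
open import Data.Nat using (ℕ; _≤_; suc)
open import Data.Fin using (Fin)
open import Data.Fin.Subset using (Subset; _∈_; _∉_; ∣_∣; ⊤; ∁)
open import Data.List using (List; []; _∷_; length; lookup; concatMap)
open import Data.Nat.ListAction using (sum)
open import Data.List.Relation.Unary.All using (All)
open import Data.List.Relation.Unary.Unique.Propositional using (Unique)
open import Data.List.Relation.Unary.Linked using (Linked)
import Data.List.Membership.Propositional as LM
open import Data.Product using (Σ; ∃; ∃-syntax; _×_; _,_)
open import Data.Sum using (_⊎_)
open import Relation.Binary.PropositionalEquality using (_≡_; _≢_)
open import Relation.Nullary using (¬_)
open import Function.Bundles using (_⇔_)

record Graph (n : ℕ) : Set where
  field
    adj    : Fin n → Fin n → Bool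
    sym    : ∀ u v → adj u v ≡ adj v u
    irrefl : ∀ v → adj v v ≡ false

open Graph public

Edge : ∀ {n} → Graph n → Fin n → Fin n → Set
Edge G u v = adj G u v ≡ true

CompleteMultipartite : ∀ {n} → Graph n → Set
CompleteMultipartite {n} G =
  ∃[ k ] Σ (Fin n → Fin k) λ part →
    ∀ u v → Edge G u v ⇔ (part u ≢ part v)

BetweenKabAndKaEb : ∀ {n} → Graph n → Set
BetweenKabAndKaEb {n} G =
  Σ ℕ λ a → Σ ℕ λ b → 1 ≤ a × a ≤ b ×
  Σ (Subset n) λ A → ∣ A ∣ ≡ a × ∣ ∁ A ∣ ≡ b ×
    (∀ u v → u ∉ A → v ∉ A → ¬ Edge G u v) ×
    (∀ u v → u ∈ A → v ∉ A → Edge G u v)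

Independent : ∀ {n} → Graph n → Subset n → Set
Independent G S = ∀ u v → u ∈ S → v ∈ S → ¬ Edge G u v

IndependenceNumber≤ : ∀ {n} → Graph n → ℕ → Set
IndependenceNumber≤ G c = ∀ S → Independent G S → ∣ S ∣ ≤ c

endpoints : ∀ {n} → List (Fin n × Fin n) → List (Fin n)
endpoints = concatMap (λ { (u , v) → u ∷ v ∷ [] })

IsMatching : ∀ {n} → Graph n → List (Fin n × Fin n) → Set
IsMatching G M = All (λ { (u , v) → Edge G u v }) M × Unique (endpoints M)

IsPerfectMatching : ∀ {n} → Graph n → List (Fin n × Fin n) → Set
IsPerfectMatching G M = IsMatching G M × (∀ v → v LM.∈ endpoints M)

IsNearPerfectMatching : ∀ {n} → Graph n → List (Fin n × Fin n) → Set
IsNearPerfectMatching G M =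
  IsMatching G M ×
  ∃[ w ] (¬ (w LM.∈ endpoints M) × (∀ v → v ≢ w → v LM.∈ endpoints M))

HasPerfectOrNearPerfectMatching : ∀ {n} → Graph n → Set
HasPerfectOrNearPerfectMatching G =
  ∃[ M ] (IsPerfectMatching G M ⊎ IsNearPerfectMatching G M)

IsHamiltonianPath : ∀ {n} → Graph n → List (Fin n) → Set
IsHamiltonianPath G P = Unique P × (∀ v → v LM.∈ P) × Linked (Edge G) P

Traceable : ∀ {n} → Graph n → Set
Traceable G = ∃[ P ] IsHamiltonianPath G P

data ReachIn {n} (G : Graph n) (S : Subset n) (u : Fin n) : Fin n → Set where
  here  : ReachIn G S u u
  there : ∀ {w x} → ReachIn G S u w → Edge G w x → x ∈ S → ReachIn G S u x

ConnectedIn : ∀ {n} → Graph n → Subset n → Set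
ConnectedIn G S = (∃[ v ] v ∈ S) × (∀ u v → u ∈ S → v ∈ S → ReachIn G S u v)

IntegerPartition : ℕ → List ℕ → Set
IntegerPartition k ps = All (1 ≤_) ps × sum ps ≡ k

IsPartitionOf : ∀ {n} → Subset n → (ps : List ℕ) → (Fin (length ps) → Subset n) → Set
IsPartitionOf {n} S ps As =
  (∀ i → ∣ As i ∣ ≡ lookup ps i) ×
  (∀ i v → v ∈ As i → v ∈ S) ×
  (∀ v → v ∈ S → ∃[ i ] v ∈ As i) ×
  (∀ i j v → v ∈ As i → v ∈ As j → i ≡ j)

ArbitrarilyPartitionable : ∀ {n} → Graph n → Set
ArbitrarilyPartitionable {n} G =
  ∀ ps → IntegerPartition n ps →
    Σ (Fin (length ps) → Subset n) λ As →
      IsPartitionOf ⊤ ps As × (∀ i → ConnectedIn G (As i))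

-- Recursively partitionable, for induced subgraphs G[S]:
-- G[S] ≅ K₁, or G[S] is connected and for every integer partition of |S|
-- into m ≥ 2 parts there is a corresponding vertex partition of S into
-- parts inducing RP subgraphs (the trivial partition m = 1 is vacuous).

data RPIn {n} (G : Graph n) (S : Subset n) : Set where
  single : ∣ S ∣ ≡ 1 → RPIn G S
  split  : ConnectedIn G S →
           (∀ ps → IntegerPartition ∣ S ∣ ps → 2 ≤ length ps →
              Σ (Fin (length ps) → Subset n) λ As →
                IsPartitionOf S ps As × (∀ i → RPIn G (As i))) →
           RPIn G S

RecursivelyPartitionable : ∀ {n} → Graph n → Set
RecursivelyPartitionable G = RPIn G ⊤

{-# OPTIONS --safe #-}

-- Everything except (i) ⇒ (iii) holds in any graph and goes through a Hamiltonian
-- path P. Cutting P into consecutive segments of prescribed sizes yields parts that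
-- are again paths, so G is recursively, hence arbitrarily, partitionable; pairing
-- consecutive vertices of P yields a (near-)perfect matching. An independent set
-- meets each edge of a matching, and each part of a partition into ⌈n/2⌉ connected
-- parts of size at most 2, in at most one vertex, so it has at most ⌈n/2⌉ vertices.
--
-- For (i) ⇒ (iii): if V = X ⊔ Y with all X–Y pairs adjacent and |Y| ≤ |X| ≤ ⌈n/2⌉,
-- then |X| ≤ |Y| + 1 and alternating between X and Y gives a Hamiltonian path. This
-- covers K_{a,b} ≤ G ≤ K_a + E_b (X = B) and a complete multipartite graph having a
-- part X of more than ⌊n/2⌋ vertices. Otherwise list the vertices as w₀, …, w_{n-1}
-- sorted by part: since parts have at most h = ⌊n/2⌋ vertices, vertices at distance
-- at least h in this list lie in different parts, so w_h w₀ w_{h+1} w₁ … is a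
-- Hamiltonian path.

module Submission where

open import Defs hiding (sym)
open import Data.Bool using (true; false)
open import Data.Empty using (⊥; ⊥-elim)
open import Data.Fin using (Fin; zero; suc; toℕ)
import Data.Fin.Properties as Fin
open import Data.Fin.Subset using (Subset; _∈_; ∣_∣; ⊤; ∁; ⁅_⁆; _∪_; Nonempty) renaming (⊥ to ∅)
open import Data.Fin.Subset.Properties
  using (_∈?_; ∈⊤; ∉⊥; ∣⊤∣≡n; ∣⊥∣≡0; nonempty?; Empty-unique; x∈⁅x⁆; x∈⁅y⁆⇒x≡y; x∈p∪q⁺; x∈p∪q⁻; x∈∁p⇒x∉p; x∉p⇒x∈∁p)
open import Data.List using (List; []; _∷_; [_]; length; map; _++_; concat; tabulate; lookup; take; drop; zip; filter; allFin)
open import Data.List.Properties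
  using (length-map; length-++; length-tabulate; length-take; length-drop; take++drop≡id; drop-drop; zip-flip)
open import Data.List.Membership.Propositional using () renaming (_∈_ to _∈ₗ_)
open import Data.List.Membership.Propositional.Properties using (∈-∃++; ∈-map⁺; ∈-map⁻; ∈-++⁻; ∈-++⁺ˡ; ∈-++⁺ʳ; ∈-concat⁺′; ∈-tabulate⁺; ∈-lookup; ∈-filter⁺; ∈-filter⁻; ∈-allFin)
open import Data.List.Relation.Binary.Permutation.Propositional using (_↭_; ↭-refl; ↭-prep; ↭-trans; ↭-sym; ↭⇒↭ₛ)
open import Data.List.Relation.Binary.Permutation.Propositional.Properties
  using (shift; ↭-length; ∈-resp-↭; ++-comm)
import Data.List.Relation.Binary.Permutation.Setoid.Properties as Permutationₛ
open import Data.List.Relation.Binary.Subset.Propositional using (_⊆_)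
open import Data.List.Relation.Binary.Subset.Propositional.Properties using (⊆∷∧∉⇒⊆; xs⊆xs++ys; xs⊆ys++xs; ∈-∷⁺ʳ)
open import Data.List.Relation.Unary.All as All using (All; []; _∷_)
import Data.List.Relation.Unary.All.Properties as AllP
open import Data.List.Relation.Unary.Any using (here; there)
open import Data.List.Relation.Unary.AllPairs using (AllPairs; []; _∷_)
import Data.List.Relation.Unary.AllPairs.Properties as APP
open import Data.List.Relation.Unary.Linked using (Linked; []; [-]; _∷_)
open import Data.List.Relation.Unary.Unique.Propositional using (Unique)
import Data.List.Relation.Unary.Unique.Propositional.Properties as UP
open import Data.Nat using (ℕ; zero; suc; _+_; _∸_; _≤_; _<_; z≤n; s≤s; ⌈_/2⌉; ⌊_/2⌋; _≤?_)
open import Data.Nat.Induction using (<-wellFounded)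
open import Data.Nat.ListAction using (sum)
open import Data.Nat.Properties
open import Data.Product using (_×_; _,_; proj₁; proj₂; ∃-syntax; uncurry; swap)
open import Data.Sum using (_⊎_; inj₁; inj₂)
open import Data.Vec using ([]; _∷_) renaming (here to hereᵥ; there to thereᵥ)
open import Function using (_∘_)
open import Function.Bundles using (Equivalence; _⇔_; mk⇔)
open import Induction.WellFounded using (Acc; acc)
open import Relation.Binary.PropositionalEquality using (_≡_; _≢_; refl; sym; trans; cong; subst; subst₂; module ≡-Reasoning; setoid)
open import Relation.Nullary using (yes; no; ¬?)
open import Relation.Unary using (Decidable)

Unique⇒length≤ : ∀ {A : Set} {xs ys : List A} → Unique xs → xs ⊆ ys → length xs ≤ length ys
Unique⇒length≤ [] _ = z≤n
Unique⇒length≤ {xs = x ∷ xs} (x∉xs ∷ u) x∷xs⊆ys with ∈-∃++ (x∷xs⊆ys (here refl))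
... | pre , post , refl =
  ≤-trans (s≤s (Unique⇒length≤ u xs⊆rest)) (≤-reflexive (sym (↭-length ys↭x∷rest)))
  where
  ys↭x∷rest : pre ++ [ x ] ++ post ↭ x ∷ pre ++ post
  ys↭x∷rest = shift x pre post
  xs⊆rest : xs ⊆ pre ++ post
  xs⊆rest = ⊆∷∧∉⇒⊆ (∈-resp-↭ ys↭x∷rest ∘ x∷xs⊆ys ∘ there) (λ x∈xs → All.lookup x∉xs x∈xs refl)

module _ {A : Set} where

  Unique-++⇒Disjoint : ∀ (xs : List A) {ys v} → Unique (xs ++ ys) → v ∈ₗ xs → v ∈ₗ ys → ⊥
  Unique-++⇒Disjoint (x ∷ xs) (x∉ ∷ _) (here refl) v∈ys = All.lookup x∉ (∈-++⁺ʳ xs v∈ys) refl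
  Unique-++⇒Disjoint (x ∷ xs) (_ ∷ u)  (there v∈xs) v∈ys = Unique-++⇒Disjoint xs u v∈xs v∈ys

  Unique-++⇒Unique : ∀ (xs : List A) {ys} → Unique (xs ++ ys) → Unique xs
  Unique-++⇒Unique []       _         = []
  Unique-++⇒Unique (x ∷ xs) (x∉ ∷ u) = AllP.++⁻ˡ xs x∉ ∷ Unique-++⇒Unique xs u

  take⊆ : ∀ k (xs : List A) → take k xs ⊆ xs
  take⊆ k xs = subst (take k xs ⊆_) (take++drop≡id k xs) (xs⊆xs++ys _ _)

  drop⊆ : ∀ k (xs : List A) → drop k xs ⊆ xs
  drop⊆ k xs = subst (drop k xs ⊆_) (take++drop≡id k xs) (xs⊆ys++xs _ _)

  module _ {R : A → A → Set} where

    Linked-take : ∀ k {xs} → Linked R xs → Linked R (take k xs)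
    Linked-take zero          _       = []
    Linked-take (suc k)       []      = []
    Linked-take (suc zero)    [-]     = [-]
    Linked-take (suc (suc k)) [-]     = [-]
    Linked-take (suc zero)    (_ ∷ _) = [-]
    Linked-take (suc (suc k)) (r ∷ l) = r ∷ Linked-take (suc k) l

    Linked-drop : ∀ k {xs} → Linked R xs → Linked R (drop k xs)
    Linked-drop zero          l       = l
    Linked-drop (suc k)       []      = []
    Linked-drop (suc zero)    [-]     = []
    Linked-drop (suc (suc k)) [-]     = []
    Linked-drop (suc k)       (_ ∷ l) = Linked-drop k l

  zip-All : ∀ {P : A × A → Set} xs ys → (∀ {x y} → x ∈ₗ xs → y ∈ₗ ys → P (x , y)) → All P (zip xs ys)
  zip-All []       _        _ = []
  zip-All (_ ∷ _)  []       _ = []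
  zip-All (x ∷ xs) (y ∷ ys) P = P (here refl) (here refl) ∷ zip-All xs ys (λ x∈ y∈ → P (there x∈) (there y∈))

  zip-++ˡ : ∀ {P : A × A → Set} xs {ys zs} → All P (zip (xs ++ ys) zs) → All P (zip xs zs)
  zip-++ˡ []       _                    = []
  zip-++ˡ (x ∷ xs) {zs = []}     _      = []
  zip-++ˡ (x ∷ xs) {zs = _ ∷ _} (p ∷ ps) = p ∷ zip-++ˡ xs ps

  zip-swap : ∀ {P : A × A → Set} xs ys → All (P ∘ swap) (zip xs ys) → All P (zip ys xs)
  zip-swap xs ys p = subst (All _) (sym (zip-flip ys xs)) (AllP.map⁺ p)

  AllPairs-of-∈ : ∀ {R : A → A → Set} xs → (∀ {x y} → x ∈ₗ xs → y ∈ₗ xs → R x y) → AllPairs R xs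
  AllPairs-of-∈ []       _ = []
  AllPairs-of-∈ (x ∷ xs) R = All.tabulate (R (here refl) ∘ there) ∷ AllPairs-of-∈ xs (λ p q → R (there p) (there q))

  drop-suc : ∀ d (xs : List A) → drop (suc d) xs ≡ drop 1 (drop d xs)
  drop-suc d xs = trans (cong (λ m → drop m xs) (+-comm 1 d)) (sym (drop-drop d 1 xs))

  AllPairs-++⇒across : ∀ {R : A → A → Set} xs {ys x y} → AllPairs R (xs ++ ys) → x ∈ₗ xs → y ∈ₗ ys → R x y
  AllPairs-++⇒across (_ ∷ xs) (r ∷ _) (here refl) y∈ = All.lookup r (∈-++⁺ʳ xs y∈)
  AllPairs-++⇒across (_ ∷ xs) (_ ∷ rs) (there x∈) y∈ = AllPairs-++⇒across xs rs x∈ y∈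

  drop≡∷⇒length-take : ∀ d (xs : List A) {b rest} → drop d xs ≡ b ∷ rest → length (take d xs) ≡ d
  drop≡∷⇒length-take zero    _        _  = refl
  drop≡∷⇒length-take (suc d) (_ ∷ xs) eq = cong suc (drop≡∷⇒length-take d xs eq)

-- Cutting a list into consecutive segments

module _ {A : Set} where

  chunk : (ps : List ℕ) → List A → Fin (length ps) → List A
  chunk (p ∷ ps) xs zero    = take p xs
  chunk (p ∷ ps) xs (suc i) = chunk ps (drop p xs) i

  private
    sum-drop : ∀ p ps (xs : List A) → p + sum ps ≡ length xs → sum ps ≡ length (drop p xs)
    sum-drop p ps xs total = begin
      sum ps                 ≡⟨ m+n∸m≡n p (sum ps) ⟨
      p + sum ps ∸ p         ≡⟨ cong (_∸ p) total ⟩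
      length xs ∸ p          ≡⟨ length-drop p xs ⟨
      length (drop p xs)     ∎
      where open ≡-Reasoning

  length-chunk : ∀ ps (xs : List A) → sum ps ≡ length xs → ∀ i → length (chunk ps xs i) ≡ lookup ps i
  length-chunk (p ∷ ps) xs total zero    =
    trans (length-take p xs) (m≤n⇒m⊓n≡m (subst (p ≤_) total (m≤m+n p (sum ps))))
  length-chunk (p ∷ ps) xs total (suc i) = length-chunk ps (drop p xs) (sum-drop p ps xs total) i

  chunk-unique : ∀ ps {xs : List A} → Unique xs → ∀ i → Unique (chunk ps xs i)
  chunk-unique (p ∷ ps) u zero    = UP.take⁺ p u
  chunk-unique (p ∷ ps) u (suc i) = chunk-unique ps (UP.drop⁺ p u) i

  chunk-linked : ∀ {R : A → A → Set} ps {xs} → Linked R xs → ∀ i → Linked R (chunk ps xs i)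
  chunk-linked (p ∷ ps) l zero    = Linked-take p l
  chunk-linked (p ∷ ps) l (suc i) = chunk-linked ps (Linked-drop p l) i

  chunk⊆ : ∀ ps (xs : List A) i → chunk ps xs i ⊆ xs
  chunk⊆ (p ∷ ps) xs zero    = take⊆ p xs
  chunk⊆ (p ∷ ps) xs (suc i) = drop⊆ p xs ∘ chunk⊆ ps (drop p xs) i

  ∈-chunk : ∀ ps (xs : List A) → sum ps ≡ length xs → ∀ {v} → v ∈ₗ xs → ∃[ i ] v ∈ₗ chunk ps xs i
  ∈-chunk []       (_ ∷ _) () _
  ∈-chunk (p ∷ ps) xs total v∈xs
    with ∈-++⁻ (take p xs) (subst (_ ∈ₗ_) (sym (take++drop≡id p xs)) v∈xs)
  ... | inj₁ v∈take = zero , v∈take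
  ... | inj₂ v∈drop with ∈-chunk ps (drop p xs) (sum-drop p ps xs total) v∈drop
  ...   | i , v∈chunk = suc i , v∈chunk

  chunk-disjoint : ∀ ps {xs : List A} → Unique xs → ∀ i j {v} →
    v ∈ₗ chunk ps xs i → v ∈ₗ chunk ps xs j → i ≡ j
  chunk-disjoint (p ∷ ps) u zero    zero    _    _    = refl
  chunk-disjoint (p ∷ ps) {xs} u zero    (suc j) v∈i v∈j =
    ⊥-elim (Unique-++⇒Disjoint (take p xs) (subst Unique (sym (take++drop≡id p xs)) u) v∈i (chunk⊆ ps _ j v∈j))
  chunk-disjoint (p ∷ ps) {xs} u (suc i) zero    v∈i v∈j =
    ⊥-elim (Unique-++⇒Disjoint (take p xs) (subst Unique (sym (take++drop≡id p xs)) u) v∈j (chunk⊆ ps _ i v∈i))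
  chunk-disjoint (p ∷ ps) u (suc i) (suc j) v∈i v∈j = cong suc (chunk-disjoint ps (UP.drop⁺ p u) i j v∈i v∈j)

lookup<sum : ∀ {ps} → All (1 ≤_) ps → 2 ≤ length ps → ∀ i → lookup ps i < sum ps
lookup<sum {_ ∷ []} _ (s≤s ()) _
lookup<sum {p ∷ q ∷ ps} (_ ∷ 1≤q ∷ _) _ zero    = m<m+n p (≤-trans 1≤q (m≤m+n q (sum ps)))
lookup<sum {p ∷ q ∷ ps} (1≤p ∷ _) _ (suc i) = <-≤-trans (s≤s (lookup≤sum (q ∷ ps) i)) (+-monoˡ-≤ (sum (q ∷ ps)) 1≤p)
  where
  lookup≤sum : ∀ ps i → lookup ps i ≤ sum ps
  lookup≤sum (p ∷ ps) zero    = m≤m+n p (sum ps)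
  lookup≤sum (p ∷ ps) (suc i) = ≤-trans (lookup≤sum ps i) (m≤n+m (sum ps) p)

module _ {A : Set} where

  interleave : List A → List A → List A
  interleave []       ys = ys
  interleave (x ∷ xs) ys = x ∷ interleave ys xs

  interleave-↭ : ∀ xs ys → interleave xs ys ↭ xs ++ ys
  interleave-↭ []       ys = ↭-refl
  interleave-↭ (x ∷ xs) ys = ↭-prep x (↭-trans (interleave-↭ ys xs) (++-comm ys xs))

  Linked-interleave : ∀ {R : A → A → Set} xs ys → length ys ≤ length xs → length xs ≤ suc (length ys) →
    All (uncurry R) (zip xs ys) → All (uncurry R) (zip ys (drop 1 xs)) → Linked R (interleave xs ys)
  Linked-interleave []            []            _         _               _        _        = []
  Linked-interleave (x ∷ [])      []            _         _               _        _        = [-]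
  Linked-interleave (x ∷ [])      (y ∷ [])      _         _               (r ∷ _)  _        = r ∷ [-]
  Linked-interleave (x ∷ x′ ∷ xs) (y ∷ ys)      (s≤s ys≤) (s≤s xs≤)       (r ∷ rs) (r′ ∷ rs′) =
    r ∷ r′ ∷ Linked-interleave (x′ ∷ xs) ys ys≤ xs≤ rs rs′
  Linked-interleave []            (_ ∷ _)       ()        _               _        _
  Linked-interleave (x ∷ [])      (_ ∷ _ ∷ _)   (s≤s ())  _               _        _
  Linked-interleave (x ∷ _ ∷ _)   []            _         (s≤s ())        _        _

module Spread {A : Set} (key : A → ℕ) where

  ClassesAtMost : ℕ → Set
  ClassesAtMost t = ∀ a (zs : List A) → Unique zs → All (λ z → key z ≡ key a) zs → length zs ≤ t

  keys-differ-at-distance : ∀ {t} w → AllPairs (λ a b → key a ≤ key b) w → Unique w → ClassesAtMost t →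
    ∀ d → t ≤ d → All (λ { (a , b) → key a ≢ key b }) (zip w (drop d w))
  keys-differ-at-distance [] _ _ _ _ _ = []
  keys-differ-at-distance (a ∷ w) _ _ atMost zero t≤0 =
    ⊥-elim (<⇒≱ (atMost a [ a ] ([] ∷ []) (refl ∷ [])) t≤0)
  keys-differ-at-distance (a ∷ w) (a≤ ∷ sorted) (a∉ ∷ unique) atMost (suc d) t≤1+d with drop d w in eq
  ... | [] = []
  ... | b ∷ rest = key-a≢key-b ∷ subst (λ r → All _ (zip w r)) (trans (drop-suc d w) (cong (drop 1) eq))
                                  (keys-differ-at-distance w sorted unique atMost (suc d) t≤1+d)
    where
    w≡ : take d w ++ b ∷ rest ≡ w
    w≡ = trans (cong (take d w ++_) (sym eq)) (take++drop≡id d w)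
    b∈w : b ∈ₗ w
    b∈w = subst (b ∈ₗ_) w≡ (∈-++⁺ʳ (take d w) (here refl))
    -- If key a ≡ key b, sortedness forces a, b and the d elements between them to
    -- share that key, giving d + 2 > t distinct elements of one key.
    key-a≢key-b : key a ≢ key b
    key-a≢key-b ka≡kb = <⇒≱ (subst (λ m → suc (suc m) ≤ _) (drop≡∷⇒length-take d w eq)
                                (atMost a segment distinct sameKey)) t≤1+d
      where
      segment : List A
      segment = a ∷ b ∷ take d w
      distinct : Unique segment
      distinct = All.tabulate (λ z∈ → All.lookup a∉ (∈-∷⁺ʳ b∈w (take⊆ d w) z∈))
               ∷ All.tabulate (λ z∈ b≡z → Unique-++⇒Disjoint (take d w) (subst Unique (sym w≡) unique) z∈ (here (sym b≡z)))
               ∷ UP.take⁺ d unique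
      sameKey : All (λ z → key z ≡ key a) segment
      sameKey = refl ∷ sym ka≡kb ∷ All.tabulate (λ z∈ → ≤-antisym
        (≤-trans (AllPairs-++⇒across (take d w) (subst (AllPairs _) (sym w≡) sorted) z∈ (here refl)) (≤-reflexive (sym ka≡kb)))
        (All.lookup a≤ (take⊆ d w z∈)))

m+m≤n⇒m≤⌊n/2⌋ : ∀ {m n} → m + m ≤ n → m ≤ ⌊ n /2⌋
m+m≤n⇒m≤⌊n/2⌋ {m} p = subst (_≤ _) (sym (n≡⌊n+n/2⌋ m)) (⌊n/2⌋-mono p)

⌈n/2⌉+⌈n/2⌉≤1+n : ∀ n → ⌈ n /2⌉ + ⌈ n /2⌉ ≤ suc n
⌈n/2⌉+⌈n/2⌉≤1+n n = ≤-trans (+-monoʳ-≤ ⌈ n /2⌉ (⌊n/2⌋≤⌈n/2⌉ (suc n))) (≤-reflexive (⌊n/2⌋+⌈n/2⌉≡n (suc n)))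

⌈n/2⌉≤1+⌊n/2⌋ : ∀ n → ⌈ n /2⌉ ≤ suc ⌊ n /2⌋
⌈n/2⌉≤1+⌊n/2⌋ zero          = z≤n
⌈n/2⌉≤1+⌊n/2⌋ (suc zero)    = ≤-refl
⌈n/2⌉≤1+⌊n/2⌋ (suc (suc n)) = s≤s (⌈n/2⌉≤1+⌊n/2⌋ n)

m≤⌈m+n/2⌉⇒m≤1+n : ∀ {m n} → m ≤ ⌈ m + n /2⌉ → m ≤ suc n
m≤⌈m+n/2⌉⇒m≤1+n {m} {n} m≤ = +-cancelˡ-≤ m m (suc n) (begin
  m + m                       ≤⟨ +-mono-≤ m≤ m≤ ⟩
  ⌈ m + n /2⌉ + ⌈ m + n /2⌉   ≤⟨ ⌈n/2⌉+⌈n/2⌉≤1+n (m + n) ⟩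
  suc (m + n)                 ≡⟨ +-suc m n ⟨
  m + suc n                   ∎)
  where open ≤-Reasoning

⌊m+n/2⌋<m⇒n≤m : ∀ {m n} → ⌊ m + n /2⌋ < m → n ≤ m
⌊m+n/2⌋<m⇒n≤m {m} {n} ⌊m+n/2⌋<m with n ≤? m
... | yes n≤m = n≤m
... | no  n≰m = ⊥-elim (<⇒≱ ⌊m+n/2⌋<m (m+m≤n⇒m≤⌊n/2⌋ (+-monoʳ-≤ m (<⇒≤ (≰⇒> n≰m)))))

twos : ℕ → List ℕ
twos zero          = []
twos (suc zero)    = [ 1 ]
twos (suc (suc n)) = 2 ∷ twos n

twos-partition : ∀ n → IntegerPartition n (twos n)
twos-partition zero          = [] , refl
twos-partition (suc zero)    = s≤s z≤n ∷ [] , refl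
twos-partition (suc (suc n)) with twos-partition n
... | positive , total = s≤s z≤n ∷ positive , cong (λ m → suc (suc m)) total

length-twos : ∀ n → length (twos n) ≡ ⌈ n /2⌉
length-twos zero          = refl
length-twos (suc zero)    = refl
length-twos (suc (suc n)) = cong suc (length-twos n)

twos-≤2 : ∀ n → All (_≤ 2) (twos n)
twos-≤2 zero          = []
twos-≤2 (suc zero)    = s≤s z≤n ∷ []
twos-≤2 (suc (suc n)) = ≤-refl ∷ twos-≤2 n

elements : ∀ {n} → Subset n → List (Fin n)
elements []            = []
elements (true  ∷ p) = zero ∷ map suc (elements p)
elements (false ∷ p) = map suc (elements p)

length-elements : ∀ {n} (p : Subset n) → length (elements p) ≡ ∣ p ∣
length-elements []            = refl
length-elements (true  ∷ p) = cong suc (trans (length-map suc (elements p)) (length-elements p))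
length-elements (false ∷ p) = trans (length-map suc (elements p)) (length-elements p)

∈-elements⁺ : ∀ {n} {p : Subset n} {v} → v ∈ p → v ∈ₗ elements p
∈-elements⁺ {p = true  ∷ p} hereᵥ      = here refl
∈-elements⁺ {p = true  ∷ p} (thereᵥ q) = there (∈-map⁺ suc (∈-elements⁺ q))
∈-elements⁺ {p = false ∷ p} (thereᵥ q) = ∈-map⁺ suc (∈-elements⁺ q)

∈-elements⁻ : ∀ {n} {p : Subset n} {v} → v ∈ₗ elements p → v ∈ p
∈-elements⁻ {p = true ∷ p} (here refl) = hereᵥ
∈-elements⁻ {p = true ∷ p} (there q) with ∈-map⁻ suc q
... | _ , q′ , refl = thereᵥ (∈-elements⁻ q′)
∈-elements⁻ {p = false ∷ p} q with ∈-map⁻ suc q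
... | _ , q′ , refl = thereᵥ (∈-elements⁻ q′)

elements-unique : ∀ {n} (p : Subset n) → Unique (elements p)
elements-unique []            = []
elements-unique (true  ∷ p) = All.tabulate zero∉ ∷ UP.map⁺ Fin.suc-injective (elements-unique p)
  where
  zero∉ : ∀ {v} → v ∈ₗ map suc (elements p) → zero ≢ v
  zero∉ q refl with ∈-map⁻ suc q
  ... | _ , _ , ()
elements-unique (false ∷ p) = UP.map⁺ Fin.suc-injective (elements-unique p)

module _ {n : ℕ} {p : Subset n} {xs : List (Fin n)} where

  ∣p∣≤length : (∀ {v} → v ∈ p → v ∈ₗ xs) → ∣ p ∣ ≤ length xs
  ∣p∣≤length p⊆xs = subst (_≤ length xs) (length-elements p)
    (Unique⇒length≤ (elements-unique p) (p⊆xs ∘ ∈-elements⁻))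

  length≤∣p∣ : Unique xs → (∀ {v} → v ∈ₗ xs → v ∈ p) → length xs ≤ ∣ p ∣
  length≤∣p∣ u xs⊆p = subst (length xs ≤_) (length-elements p)
    (Unique⇒length≤ u (∈-elements⁺ ∘ xs⊆p))

length-enumeration : ∀ {n} {xs : List (Fin n)} → Unique xs → (∀ v → v ∈ₗ xs) → length xs ≡ n
length-enumeration {n} u complete = trans
  (≤-antisym (length≤∣p∣ {p = ⊤} u (λ _ → ∈⊤)) (∣p∣≤length {p = ⊤} (λ {v} _ → complete v)))
  (∣⊤∣≡n n)

fromList : ∀ {n} → List (Fin n) → Subset n
fromList []       = ∅
fromList (x ∷ xs) = ⁅ x ⁆ ∪ fromList xs

∈-fromList⁺ : ∀ {n} {xs : List (Fin n)} {v} → v ∈ₗ xs → v ∈ fromList xs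
∈-fromList⁺ (here refl) = x∈p∪q⁺ (inj₁ (x∈⁅x⁆ _))
∈-fromList⁺ (there q)   = x∈p∪q⁺ (inj₂ (∈-fromList⁺ q))

∈-fromList⁻ : ∀ {n} {xs : List (Fin n)} {v} → v ∈ fromList xs → v ∈ₗ xs
∈-fromList⁻ {xs = []} q = ⊥-elim (∉⊥ q)
∈-fromList⁻ {xs = x ∷ xs} q with x∈p∪q⁻ ⁅ x ⁆ (fromList xs) q
... | inj₁ q′ = here (x∈⁅y⁆⇒x≡y x q′)
... | inj₂ q′ = there (∈-fromList⁻ q′)

∣fromList∣≡length : ∀ {n} {xs : List (Fin n)} → Unique xs → ∣ fromList xs ∣ ≡ length xs
∣fromList∣≡length {xs = xs} u =
  ≤-antisym (∣p∣≤length {xs = xs} ∈-fromList⁻) (length≤∣p∣ u ∈-fromList⁺)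

length≤n : ∀ {n} {xs : List (Fin n)} → Unique xs → length xs ≤ n
length≤n {n} {xs} u = subst (length xs ≤_) (∣⊤∣≡n n) (length≤∣p∣ {p = ⊤} u (λ _ → ∈⊤))

∣p∣≥1⇒nonempty : ∀ {n} {p : Subset n} → 1 ≤ ∣ p ∣ → Nonempty p
∣p∣≥1⇒nonempty {n} {p} 1≤∣p∣ with nonempty? p
... | yes nonempty = nonempty
... | no  empty    = ⊥-elim (<⇒≱ 1≤∣p∣ (≤-reflexive (trans (cong ∣_∣ (Empty-unique empty)) (∣⊥∣≡0 n))))

∣p∣≤1⇒≡ : ∀ {n} {p : Subset n} {u v} → ∣ p ∣ ≤ 1 → u ∈ p → v ∈ p → u ≡ v
∣p∣≤1⇒≡ {p = p} {u} {v} ∣p∣≤1 u∈p v∈p with u Fin.≟ v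
... | yes u≡v = u≡v
... | no  u≢v = ⊥-elim (<⇒≱ (length≤∣p∣ {p = p} ((u≢v ∷ []) ∷ [] ∷ []) ⊆p) ∣p∣≤1)
  where
  ⊆p : ∀ {z} → z ∈ₗ u ∷ v ∷ [] → z ∈ p
  ⊆p (here refl)         = u∈p
  ⊆p (there (here refl)) = v∈p

-- Covering an independent set by blocks

AtMostOneIn : ∀ {n} → Subset n → List (Fin n) → Set
AtMostOneIn S B = ∀ {u v} → u ∈ₗ B → v ∈ₗ B → u ∈ S → v ∈ S → u ≡ v

∣p∣≤#blocks : ∀ {n} {S : Subset n} (Bs : List (List (Fin n))) →
  (∀ {v} → v ∈ S → v ∈ₗ concat Bs) → All (AtMostOneIn S) Bs → ∣ S ∣ ≤ length Bs
∣p∣≤#blocks {n} {S} Bs covers once =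
  ≤-trans (∣p∣≤length (λ v∈S → ∈-representatives once (covers v∈S) v∈S)) (length-representatives Bs)
  where
  firstIn : List (Fin n) → List (Fin n)
  firstIn [] = []
  firstIn (x ∷ B) with x ∈? S
  ... | yes _ = [ x ]
  ... | no  _ = firstIn B

  length-firstIn : ∀ B → length (firstIn B) ≤ 1
  length-firstIn [] = z≤n
  length-firstIn (x ∷ B) with x ∈? S
  ... | yes _ = ≤-refl
  ... | no  _ = length-firstIn B

  ∈-firstIn : ∀ {B v} → AtMostOneIn S B → v ∈ₗ B → v ∈ S → v ∈ₗ firstIn B
  ∈-firstIn {x ∷ B} once v∈B v∈S with x ∈? S | v∈B
  ... | yes x∈S | _          = here (once v∈B (here refl) v∈S x∈S)
  ... | no  x∉S | here refl  = ⊥-elim (x∉S v∈S)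
  ... | no  _   | there v∈B′ = ∈-firstIn (λ p q → once (there p) (there q)) v∈B′ v∈S

  representatives : List (List (Fin n)) → List (Fin n)
  representatives = concat ∘ map firstIn

  length-representatives : ∀ Bs → length (representatives Bs) ≤ length Bs
  length-representatives [] = z≤n
  length-representatives (B ∷ Bs) = begin
    length (firstIn B ++ representatives Bs)        ≡⟨ length-++ (firstIn B) ⟩
    length (firstIn B) + length (representatives Bs) ≤⟨ +-mono-≤ (length-firstIn B) (length-representatives Bs) ⟩
    suc (length Bs)                                  ∎
    where open ≤-Reasoning

  ∈-representatives : ∀ {Bs v} → All (AtMostOneIn S) Bs → v ∈ₗ concat Bs → v ∈ S → v ∈ₗ representatives Bs
  ∈-representatives {B ∷ Bs} (onceB ∷ once) v∈ v∈S with ∈-++⁻ B v∈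
  ... | inj₁ v∈B  = ∈-++⁺ˡ (∈-firstIn onceB v∈B v∈S)
  ... | inj₂ v∈Bs = ∈-++⁺ʳ (firstIn B) (∈-representatives once v∈Bs v∈S)

-- concat (pairBlocks M) reduces to endpoints M.
pairBlocks : ∀ {n} → List (Fin n × Fin n) → List (List (Fin n))
pairBlocks = map (λ e → proj₁ e ∷ proj₂ e ∷ [])

length-endpoints : ∀ {n} (M : List (Fin n × Fin n)) → length (endpoints M) ≡ length M + length M
length-endpoints []      = refl
length-endpoints (_ ∷ M) = cong suc (trans (cong suc (length-endpoints M)) (sym (+-suc _ _)))

module _ {n : ℕ} (G : Graph n) where

  Edge-sym : ∀ {u v} → Edge G u v → Edge G v u
  Edge-sym {u} {v} e = trans (Graph.sym G v u) e

  Edge-irrefl : ∀ {u v} → Edge G u v → u ≢ v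
  Edge-irrefl {u} e refl with trans (sym e) (irrefl G u)
  ... | ()

  AtMostOneIn-edge : ∀ {S u v} → Independent G S → Edge G u v → AtMostOneIn S (u ∷ v ∷ [])
  AtMostOneIn-edge ind e (here refl)         (here refl)         _   _   = refl
  AtMostOneIn-edge ind e (here refl)         (there (here refl)) u∈S v∈S = ⊥-elim (ind _ _ u∈S v∈S e)
  AtMostOneIn-edge ind e (there (here refl)) (here refl)         v∈S u∈S = ⊥-elim (ind _ _ u∈S v∈S e)
  AtMostOneIn-edge ind e (there (here refl)) (there (here refl)) _   _   = refl

  pairBlocks-AtMostOneIn : ∀ {S} {M : List (Fin n × Fin n)} → Independent G S →
    All (λ { (u , v) → Edge G u v }) M → All (AtMostOneIn S) (pairBlocks M)
  pairBlocks-AtMostOneIn ind edges = AllP.map⁺ (All.map (AtMostOneIn-edge ind) edges)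

  matching⇒α≤⌈n/2⌉ : HasPerfectOrNearPerfectMatching G → IndependenceNumber≤ G ⌈ n /2⌉
  matching⇒α≤⌈n/2⌉ (M , inj₁ ((edges , unique) , covers)) S ind = begin
    ∣ S ∣                ≤⟨ ∣p∣≤#blocks (pairBlocks M) (λ {v} _ → covers v) (pairBlocks-AtMostOneIn ind edges) ⟩
    length (pairBlocks M) ≡⟨ length-map _ M ⟩
    length M             ≤⟨ m+m≤n⇒m≤⌊n/2⌋ (subst (_≤ n) (length-endpoints M) (length≤n unique)) ⟩
    ⌊ n /2⌋              ≤⟨ ⌊n/2⌋≤⌈n/2⌉ n ⟩
    ⌈ n /2⌉              ∎
    where open ≤-Reasoning
  matching⇒α≤⌈n/2⌉ (M , inj₂ ((edges , unique) , w , w∉ , covers)) S ind = begin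
    ∣ S ∣                       ≤⟨ ∣p∣≤#blocks ([ w ] ∷ pairBlocks M) covers′ (singleton ∷ pairBlocks-AtMostOneIn ind edges) ⟩
    suc (length (pairBlocks M)) ≡⟨ cong suc (length-map _ M) ⟩
    suc (length M)              ≤⟨ m+m≤n⇒m≤⌊n/2⌋ (s≤s (subst (_≤ n) length-w∷endpoints (length≤n unique′))) ⟩
    ⌈ n /2⌉                     ∎
    where
    open ≤-Reasoning
    covers′ : ∀ {v} → v ∈ S → v ∈ₗ w ∷ endpoints M
    covers′ {v} _ with v Fin.≟ w
    ... | yes refl = here refl
    ... | no  v≢w  = there (covers v v≢w)
    singleton : AtMostOneIn S [ w ]
    singleton (here refl) (here refl) _ _ = refl
    unique′ : Unique (w ∷ endpoints M)
    unique′ = All.tabulate (λ { v∈ refl → w∉ v∈ }) ∷ unique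
    length-w∷endpoints : length (w ∷ endpoints M) ≡ length M + suc (length M)
    length-w∷endpoints = trans (cong suc (length-endpoints M)) (sym (+-suc (length M) (length M)))

  ReachIn-endpoint : ∀ {X u w} → ReachIn G X u w → w ≡ u ⊎ w ∈ X
  ReachIn-endpoint here            = inj₁ refl
  ReachIn-endpoint (there _ _ w∈X) = inj₂ w∈X

  connected-∣p∣≤2⇒Edge : ∀ {X u v} → ConnectedIn G X → ∣ X ∣ ≤ 2 → u ∈ X → v ∈ X → u ≢ v → Edge G u v
  connected-∣p∣≤2⇒Edge {X} {u} {v} (_ , reach) ∣X∣≤2 u∈X v∈X u≢v with reach u v u∈X v∈X
  ... | here = ⊥-elim (u≢v refl)
  ... | there {w} r e _ with w Fin.≟ u | ReachIn-endpoint r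
  ...   | yes refl | _        = e
  ...   | no  w≢u  | inj₁ w≡u = ⊥-elim (w≢u w≡u)
  ...   | no  w≢u  | inj₂ w∈X = ⊥-elim (<⇒≱ (length≤∣p∣ {p = X} distinct ⊆X) ∣X∣≤2)
    where
    distinct : Unique (u ∷ v ∷ w ∷ [])
    distinct = (u≢v ∷ (w≢u ∘ sym) ∷ []) ∷ ((Edge-irrefl e ∘ sym) ∷ []) ∷ [] ∷ []
    ⊆X : ∀ {z} → z ∈ₗ u ∷ v ∷ w ∷ [] → z ∈ X
    ⊆X (here refl)                 = u∈X
    ⊆X (there (here refl))         = v∈X
    ⊆X (there (there (here refl))) = w∈X

  ap⇒α≤⌈n/2⌉ : ArbitrarilyPartitionable G → IndependenceNumber≤ G ⌈ n /2⌉
  ap⇒α≤⌈n/2⌉ ap S ind with ap (twos n) (twos-partition n)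
  ... | As , (sizes , _ , covers , _) , connected = begin
    ∣ S ∣                  ≤⟨ ∣p∣≤#blocks blocks covers′ (AllP.tabulate⁺ once) ⟩
    length blocks          ≡⟨ length-tabulate _ ⟩
    length (twos n)        ≡⟨ length-twos n ⟩
    ⌈ n /2⌉                ∎
    where
    open ≤-Reasoning
    blocks : List (List (Fin n))
    blocks = tabulate (elements ∘ As)
    covers′ : ∀ {v} → v ∈ S → v ∈ₗ concat blocks
    covers′ {v} _ with covers v ∈⊤
    ... | i , v∈Ai = ∈-concat⁺′ (∈-elements⁺ v∈Ai) (∈-tabulate⁺ i)
    once : ∀ i → AtMostOneIn S (elements (As i))
    once i {u} {v} u∈ v∈ u∈S v∈S with u Fin.≟ v
    ... | yes u≡v = u≡v
    ... | no  u≢v = ⊥-elim (ind u v u∈S v∈S (connected-∣p∣≤2⇒Edge (connected i) ∣Ai∣≤2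
                      (∈-elements⁻ u∈) (∈-elements⁻ v∈) u≢v))
      where
      ∣Ai∣≤2 : ∣ As i ∣ ≤ 2
      ∣Ai∣≤2 = subst (_≤ 2) (sym (sizes i)) (All.lookup (twos-≤2 n) (∈-lookup i))

  -- Partitions along a Hamiltonian path

  RPIn⇒ConnectedIn : ∀ {S} → RPIn G S → ConnectedIn G S
  RPIn⇒ConnectedIn (single ∣S∣≡1) =
    ∣p∣≥1⇒nonempty (≤-reflexive (sym ∣S∣≡1)) ,
    λ u v u∈S v∈S → subst (ReachIn G _ u) (∣p∣≤1⇒≡ (≤-reflexive ∣S∣≡1) u∈S v∈S) here
  RPIn⇒ConnectedIn (split connected _) = connected

  rp⇒ap : RecursivelyPartitionable G → ArbitrarilyPartitionable G
  rp⇒ap rp [] (_ , 0≡n) with RPIn⇒ConnectedIn rp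
  ... | (v , _) , _ = ⊥-elim (Fin.¬Fin0 (subst Fin (sym 0≡n) v))
  rp⇒ap rp (p ∷ []) (_ , p+0≡n) =
    (λ _ → ⊤) , ((λ { zero → trans (∣⊤∣≡n n) (trans (sym p+0≡n) (+-identityʳ p)) }) ,
                 (λ _ _ v∈ → v∈) , (λ _ _ → zero , ∈⊤) , λ { zero zero _ _ _ → refl }) ,
    λ _ → RPIn⇒ConnectedIn rp
  rp⇒ap (single ∣⊤∣≡1) (p ∷ q ∷ ps) (1≤p ∷ 1≤q ∷ _ , total) =
    ⊥-elim (<⇒≱ (+-mono-≤ 1≤p (≤-trans 1≤q (m≤m+n q _)))
                (≤-reflexive (trans total (trans (sym (∣⊤∣≡n n)) ∣⊤∣≡1))))
  rp⇒ap (split _ partition) (p ∷ q ∷ ps) (positive , total)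
    with partition (p ∷ q ∷ ps) (positive , trans total (sym (∣⊤∣≡n n))) (s≤s (s≤s z≤n))
  ... | As , isPartition , rps = As , isPartition , λ i → RPIn⇒ConnectedIn (rps i)

  prepend : ∀ {X a b y} → Edge G a b → b ∈ X → ReachIn G X b y → ReachIn G X a y
  prepend e b∈X here               = there here e b∈X
  prepend e b∈X (there r e′ y∈X)   = there (prepend e b∈X r) e′ y∈X

  Linked⇒ReachIn : ∀ {X P} → Linked (Edge G) P → (∀ {v} → v ∈ₗ P → v ∈ X) →
    ∀ {u v} → u ∈ₗ P → v ∈ₗ P → ReachIn G X u v
  Linked⇒ReachIn l       ⊆X (here refl) (here refl) = here
  Linked⇒ReachIn [-]     ⊆X (here refl) (there ())
  Linked⇒ReachIn [-]     ⊆X (there ())  _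
  Linked⇒ReachIn (e ∷ l) ⊆X (here refl) (there v∈P) =
    prepend e (⊆X (there (here refl))) (Linked⇒ReachIn l (⊆X ∘ there) (here refl) v∈P)
  Linked⇒ReachIn (e ∷ l) ⊆X (there u∈P) (here refl) =
    there (Linked⇒ReachIn l (⊆X ∘ there) u∈P (here refl)) (Edge-sym e) (⊆X (here refl))
  Linked⇒ReachIn (_ ∷ l) ⊆X (there u∈P) (there v∈P) = Linked⇒ReachIn l (⊆X ∘ there) u∈P v∈P

  record IsHamiltonianPathIn (S : Subset n) (P : List (Fin n)) : Set where
    field
      unique : Unique P
      linked : Linked (Edge G) P
      ⊆S     : ∀ {v} → v ∈ₗ P → v ∈ S
      S⊆     : ∀ {v} → v ∈ S → v ∈ₗ P

  hamiltonianPathIn⇒ConnectedIn : ∀ {S a P} → IsHamiltonianPathIn S (a ∷ P) → ConnectedIn G S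
  hamiltonianPathIn⇒ConnectedIn path =
    (_ , ⊆S (here refl)) , λ u v u∈S v∈S → Linked⇒ReachIn linked ⊆S (S⊆ u∈S) (S⊆ v∈S)
    where open IsHamiltonianPathIn path

  chunk-hamiltonianPathIn : ∀ {S P} → IsHamiltonianPathIn S P → ∀ ps i →
    IsHamiltonianPathIn (fromList (chunk ps P i)) (chunk ps P i)
  chunk-hamiltonianPathIn path ps i = record
    { unique = chunk-unique ps unique i
    ; linked = chunk-linked ps linked i
    ; ⊆S     = ∈-fromList⁺
    ; S⊆     = ∈-fromList⁻
    }
    where open IsHamiltonianPathIn path

  chunks-partition : ∀ {S P} → IsHamiltonianPathIn S P → ∀ ps → sum ps ≡ length P →
    IsPartitionOf S ps (fromList ∘ chunk ps P)
  chunks-partition {P = P} path ps total =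
    (λ i → trans (∣fromList∣≡length (chunk-unique ps unique i)) (length-chunk ps P total i)) ,
    (λ i v v∈ → ⊆S (chunk⊆ ps P i (∈-fromList⁻ v∈))) ,
    (λ v v∈S → let i , v∈i = ∈-chunk ps P total (S⊆ v∈S) in i , ∈-fromList⁺ v∈i) ,
    (λ i j v v∈i v∈j → chunk-disjoint ps unique i j (∈-fromList⁻ v∈i) (∈-fromList⁻ v∈j))
    where open IsHamiltonianPathIn path

  hamiltonianPathIn⇒RPIn : ∀ {S P} → IsHamiltonianPathIn S P → 1 ≤ length P → Acc _<_ (length P) → RPIn G S
  hamiltonianPathIn⇒RPIn {S} {a ∷ P} path _ (acc smaller) =
    split (hamiltonianPathIn⇒ConnectedIn path) λ ps (positive , total) 2≤#ps →
      let total′ = trans total ∣S∣≡length in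
      fromList ∘ chunk ps (a ∷ P) , chunks-partition path ps total′ , λ i →
        hamiltonianPathIn⇒RPIn (chunk-hamiltonianPathIn path ps i)
          (subst (1 ≤_) (sym (length-chunk ps _ total′ i)) (All.lookup positive (∈-lookup i)))
          (smaller (subst₂ _<_ (sym (length-chunk ps _ total′ i)) total′ (lookup<sum positive 2≤#ps i)))
    where
    open IsHamiltonianPathIn path
    ∣S∣≡length : ∣ S ∣ ≡ length (a ∷ P)
    ∣S∣≡length = ≤-antisym (∣p∣≤length S⊆) (length≤∣p∣ unique ⊆S)

  traceable⇒rp : Traceable G → 1 ≤ n → RecursivelyPartitionable G
  traceable⇒rp (P , unique , complete , linked) 1≤n =
    hamiltonianPathIn⇒RPIn path (subst (1 ≤_) (sym (length-enumeration unique complete)) 1≤n) (<-wellFounded _)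
    where
    path : IsHamiltonianPathIn ⊤ P
    path = record { unique = unique ; linked = linked ; ⊆S = λ _ → ∈⊤ ; S⊆ = λ {v} _ → complete v }

  consecutivePairs : List (Fin n) → List (Fin n × Fin n)
  consecutivePairs (u ∷ v ∷ P) = (u , v) ∷ consecutivePairs P
  consecutivePairs _           = []

  consecutivePairs-edges : ∀ {P} → Linked (Edge G) P → All (λ { (u , v) → Edge G u v }) (consecutivePairs P)
  consecutivePairs-edges []              = []
  consecutivePairs-edges [-]             = []
  consecutivePairs-edges (e ∷ [-])       = e ∷ []
  consecutivePairs-edges (e ∷ (_ ∷ l))   = e ∷ consecutivePairs-edges l

  endpoints-consecutivePairs : ∀ P → endpoints (consecutivePairs P) ≡ P ⊎ ∃[ w ] endpoints (consecutivePairs P) ++ [ w ] ≡ P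
  endpoints-consecutivePairs []          = inj₁ refl
  endpoints-consecutivePairs (w ∷ [])    = inj₂ (w , refl)
  endpoints-consecutivePairs (u ∷ v ∷ P) with endpoints-consecutivePairs P
  ... | inj₁ e       = inj₁ (cong (λ Q → u ∷ v ∷ Q) e)
  ... | inj₂ (w , e) = inj₂ (w , cong (λ Q → u ∷ v ∷ Q) e)

  traceable⇒matching : Traceable G → HasPerfectOrNearPerfectMatching G
  traceable⇒matching (P , unique , complete , linked) with endpoints-consecutivePairs P
  ... | inj₁ e = consecutivePairs P , inj₁
    ((consecutivePairs-edges linked , subst Unique (sym e) unique) , λ v → subst (v ∈ₗ_) (sym e) (complete v))
  ... | inj₂ (w , e) = consecutivePairs P , inj₂
    ((consecutivePairs-edges linked , Unique-++⇒Unique (endpoints (consecutivePairs P)) unique′) ,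
     w , (λ w∈ → Unique-++⇒Disjoint _ unique′ w∈ (here refl)) , covered)
    where
    unique′ : Unique (endpoints (consecutivePairs P) ++ [ w ])
    unique′ = subst Unique (sym e) unique
    covered : ∀ v → v ≢ w → v ∈ₗ endpoints (consecutivePairs P)
    covered v v≢w with ∈-++⁻ (endpoints (consecutivePairs P)) (subst (v ∈ₗ_) (sym e) (complete v))
    ... | inj₁ v∈         = v∈
    ... | inj₂ (here v≡w) = ⊥-elim (v≢w v≡w)

  -- Hamiltonian paths in the two classes

  interleaving⇒traceable : ∀ xs ys → Unique (ys ++ xs) → (∀ v → v ∈ₗ ys ++ xs) →
    length ys ≤ length xs → length xs ≤ suc (length ys) →
    All (uncurry (Edge G)) (zip xs ys) → All (uncurry (Edge G)) (zip ys (drop 1 xs)) → Traceable G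
  interleaving⇒traceable xs ys unique complete ys≤xs xs≤1+ys edges edges′ =
    interleave xs ys ,
    Permutationₛ.Unique-resp-↭ (setoid (Fin n)) (↭⇒↭ₛ (↭-sym interleave↭ys++xs)) unique ,
    (λ v → ∈-resp-↭ (↭-sym interleave↭ys++xs) (complete v)) ,
    Linked-interleave xs ys ys≤xs xs≤1+ys edges edges′
    where
    interleave↭ys++xs : interleave xs ys ↭ ys ++ xs
    interleave↭ys++xs = ↭-trans (interleave-↭ xs ys) (++-comm xs ys)

  completeBipartite⇒traceable : ∀ xs ys → Unique (ys ++ xs) → (∀ v → v ∈ₗ ys ++ xs) →
    (∀ {x y} → x ∈ₗ xs → y ∈ₗ ys → Edge G x y) →
    length ys ≤ length xs → length xs ≤ ⌈ n /2⌉ → Traceable G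
  completeBipartite⇒traceable xs ys unique complete adjacent ys≤xs xs≤⌈n/2⌉ =
    interleaving⇒traceable xs ys unique complete ys≤xs xs≤1+ys
      (zip-All xs ys adjacent) (zip-All ys (drop 1 xs) (λ y∈ x∈ → Edge-sym (adjacent (drop⊆ 1 xs x∈) y∈)))
    where
    n≡ : n ≡ length xs + length ys
    n≡ = trans (sym (length-enumeration unique complete)) (trans (length-++ ys) (+-comm (length ys) (length xs)))
    xs≤1+ys : length xs ≤ suc (length ys)
    xs≤1+ys = m≤⌈m+n/2⌉⇒m≤1+n (subst (λ m → length xs ≤ ⌈ m /2⌉) n≡ xs≤⌈n/2⌉)

  betweenKabAndKaEb⇒traceable : BetweenKabAndKaEb G → IndependenceNumber≤ G ⌈ n /2⌉ → Traceable G
  betweenKabAndKaEb⇒traceable (a , b , _ , a≤b , A , ∣A∣≡a , ∣∁A∣≡b , B-independent , A-B-adjacent) α =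
    completeBipartite⇒traceable (elements (∁ A)) (elements A) unique complete adjacent
      (subst₂ _≤_ (sym (trans (length-elements A) ∣A∣≡a)) (sym (trans (length-elements (∁ A)) ∣∁A∣≡b)) a≤b)
      (subst (_≤ ⌈ n /2⌉) (sym (length-elements (∁ A))) (α (∁ A) ∁A-independent))
    where
    ∁A-independent : Independent G (∁ A)
    ∁A-independent u v u∈ v∈ = B-independent u v (x∈∁p⇒x∉p u∈) (x∈∁p⇒x∉p v∈)
    unique : Unique (elements A ++ elements (∁ A))
    unique = UP.++⁺ (elements-unique A) (elements-unique (∁ A))
      (λ (v∈A , v∈∁A) → x∈∁p⇒x∉p (∈-elements⁻ v∈∁A) (∈-elements⁻ {p = A} v∈A))
    complete : ∀ v → v ∈ₗ elements A ++ elements (∁ A)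
    complete v with v ∈? A
    ... | yes v∈A = ∈-++⁺ˡ (∈-elements⁺ v∈A)
    ... | no  v∉A = ∈-++⁺ʳ (elements A) (∈-elements⁺ (x∉p⇒x∈∁p v∉A))
    adjacent : ∀ {x y} → x ∈ₗ elements (∁ A) → y ∈ₗ elements A → Edge G x y
    adjacent x∈ y∈ = Edge-sym (A-B-adjacent _ _ (∈-elements⁻ y∈) (x∈∁p⇒x∉p (∈-elements⁻ x∈)))

module Multipartite {n k : ℕ} (G : Graph n) (part : Fin n → Fin k)
                    (adjacent⇔ : ∀ u v → Edge G u v ⇔ (part u ≢ part v)) where

  key : Fin n → ℕ
  key = toℕ ∘ part

  open Spread key

  partList : Fin k → List (Fin n)
  partList c = filter (λ v → part v Fin.≟ c) (allFin n)

  partList-unique : ∀ c → Unique (partList c)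
  partList-unique c = UP.filter⁺ (λ v → part v Fin.≟ c) (UP.allFin⁺ n)

  ∈-partList⁺ : ∀ {v c} → part v ≡ c → v ∈ₗ partList c
  ∈-partList⁺ {v} {c} = ∈-filter⁺ (λ v → part v Fin.≟ c) (∈-allFin v)

  ∈-partList⁻ : ∀ {v c} → v ∈ₗ partList c → part v ≡ c
  ∈-partList⁻ {c = c} = proj₂ ∘ ∈-filter⁻ (λ v → part v Fin.≟ c) {xs = allFin n}

  differentParts⇒Edge : ∀ {u v} → part u ≢ part v → Edge G u v
  differentParts⇒Edge = Equivalence.from (adjacent⇔ _ _)

  byPart : List (Fin n)
  byPart = concat (tabulate partList)

  byPart-unique : Unique byPart
  byPart-unique = UP.concat⁺ (AllP.tabulate⁺ partList-unique)
    (APP.tabulate⁺ λ c≢d (v∈c , v∈d) → c≢d (trans (sym (∈-partList⁻ v∈c)) (∈-partList⁻ v∈d)))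

  byPart-complete : ∀ v → v ∈ₗ byPart
  byPart-complete v = ∈-concat⁺′ (∈-partList⁺ refl) (∈-tabulate⁺ (part v))

  byPart-sorted : AllPairs (λ u v → key u ≤ key v) byPart
  byPart-sorted = APP.concat⁺
    (AllP.tabulate⁺ λ c → AllPairs-of-∈ (partList c) λ u∈ v∈ →
      ≤-reflexive (cong toℕ (trans (∈-partList⁻ u∈) (sym (∈-partList⁻ v∈)))))
    (APP.tabulate⁺-< λ c<d → All.tabulate λ u∈ → All.tabulate λ v∈ →
      subst₂ _≤_ (cong toℕ (sym (∈-partList⁻ u∈))) (cong toℕ (sym (∈-partList⁻ v∈))) (<⇒≤ c<d))

  -- The path w_h w₀ w_{h+1} w₁ … has consecutive vertices h or h + 1 apart in byPart.
  smallParts⇒traceable : (∀ c → length (partList c) ≤ ⌊ n /2⌋) → Traceable G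
  smallParts⇒traceable small =
    interleaving⇒traceable G (drop h byPart) (take h byPart)
      (subst Unique (sym (take++drop≡id h byPart)) byPart-unique)
      (λ v → subst (v ∈ₗ_) (sym (take++drop≡id h byPart)) (byPart-complete v))
      (subst₂ _≤_ (sym length-take-h) (sym length-drop-h) (⌊n/2⌋≤⌈n/2⌉ n))
      (subst₂ _≤_ (sym length-drop-h) (cong suc (sym length-take-h)) (⌈n/2⌉≤1+⌊n/2⌋ n))
      (zip-swap (take h byPart) (drop h byPart)
        (All.map (λ ≢ → differentParts⇒Edge (≢ ∘ cong toℕ ∘ sym)) (keysDiffer h ≤-refl)))
      (subst (λ r → All _ (zip (take h byPart) r)) (drop-suc h byPart)
        (All.map (λ ≢ → differentParts⇒Edge (≢ ∘ cong toℕ)) (keysDiffer (suc h) (n≤1+n h))))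
    where
    h : ℕ
    h = ⌊ n /2⌋
    classes : ClassesAtMost h
    classes a zs unique sameKey = ≤-trans
      (Unique⇒length≤ unique (λ z∈ → ∈-partList⁺ (Fin.toℕ-injective (All.lookup sameKey z∈)))) (small (part a))
    keysDiffer : ∀ d → h ≤ d → All (λ { (u , v) → key u ≢ key v }) (zip (take h byPart) (drop d byPart))
    keysDiffer d h≤d = zip-++ˡ (take h byPart)
      (subst (λ l → All (λ { (u , v) → key u ≢ key v }) (zip l (drop d byPart))) (sym (take++drop≡id h byPart))
        (keys-differ-at-distance byPart byPart-sorted byPart-unique classes d h≤d))
    length-take-h : length (take h byPart) ≡ h
    length-take-h = trans (length-take h byPart)
      (m≤n⇒m⊓n≡m (subst (h ≤_) (sym (length-enumeration byPart-unique byPart-complete)) (⌊n/2⌋≤n n)))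
    length-drop-h : length (drop h byPart) ≡ ⌈ n /2⌉
    length-drop-h = trans (length-drop h byPart)
      (trans (cong (_∸ h) (trans (length-enumeration byPart-unique byPart-complete) (sym (⌊n/2⌋+⌈n/2⌉≡n n))))
             (m+n∸m≡n h ⌈ n /2⌉))

  largePart⇒traceable : IndependenceNumber≤ G ⌈ n /2⌉ → ∀ c → ⌊ n /2⌋ < length (partList c) → Traceable G
  largePart⇒traceable α c large =
    completeBipartite⇒traceable G (partList c) rest unique complete adjacent
      (⌊m+n/2⌋<m⇒n≤m (subst (λ m → ⌊ m /2⌋ < length (partList c)) n≡ large))
      (subst (_≤ ⌈ n /2⌉) (∣fromList∣≡length (partList-unique c)) (α (fromList (partList c)) independent))
    where
    outside? : Decidable (λ v → part v ≢ c)
    outside? v = ¬? (part v Fin.≟ c)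
    rest : List (Fin n)
    rest = filter outside? (allFin n)
    unique : Unique (rest ++ partList c)
    unique = UP.++⁺ (UP.filter⁺ outside? (UP.allFin⁺ n)) (partList-unique c)
      (λ (v∈rest , v∈c) → proj₂ (∈-filter⁻ outside? {xs = allFin n} v∈rest) (∈-partList⁻ v∈c))
    complete : ∀ v → v ∈ₗ rest ++ partList c
    complete v with part v Fin.≟ c
    ... | yes v∈c = ∈-++⁺ʳ rest (∈-partList⁺ v∈c)
    ... | no  v∉c = ∈-++⁺ˡ (∈-filter⁺ outside? (∈-allFin v) v∉c)
    adjacent : ∀ {x y} → x ∈ₗ partList c → y ∈ₗ rest → Edge G x y
    adjacent x∈ y∈ = differentParts⇒Edge λ x≡y →
      proj₂ (∈-filter⁻ outside? {xs = allFin n} y∈) (trans (sym x≡y) (∈-partList⁻ x∈))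
    n≡ : n ≡ length (partList c) + length rest
    n≡ = trans (sym (length-enumeration unique complete)) (trans (length-++ rest) (+-comm (length rest) _))
    independent : Independent G (fromList (partList c))
    independent u v u∈ v∈ e = Equivalence.to (adjacent⇔ u v) e
      (trans (∈-partList⁻ (∈-fromList⁻ u∈)) (sym (∈-partList⁻ (∈-fromList⁻ v∈))))

  completeMultipartite⇒traceable : IndependenceNumber≤ G ⌈ n /2⌉ → Traceable G
  completeMultipartite⇒traceable α with Fin.all? (λ c → length (partList c) ≤? ⌊ n /2⌋)
  ... | yes small = smallParts⇒traceable small
  ... | no  ¬small with Fin.¬∀⟶∃¬ k _ (λ c → length (partList c) ≤? ⌊ n /2⌋) ¬small
  ...   | c , ¬small-c = largePart⇒traceable α c (≰⇒> ¬small-c)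

α≤⌈n/2⌉⇒traceable : ∀ {n} (G : Graph n) → CompleteMultipartite G ⊎ BetweenKabAndKaEb G →
  IndependenceNumber≤ G ⌈ n /2⌉ → Traceable G
α≤⌈n/2⌉⇒traceable G (inj₁ (_ , part , adjacent⇔)) = Multipartite.completeMultipartite⇒traceable G part adjacent⇔
α≤⌈n/2⌉⇒traceable G (inj₂ between)               = betweenKabAndKaEb⇒traceable G between

proposition12 : (n : ℕ) → 1 ≤ n → (G : Graph n) →
    (CompleteMultipartite G ⊎ BetweenKabAndKaEb G) →
    (IndependenceNumber≤ G ⌈ n /2⌉ ⇔ HasPerfectOrNearPerfectMatching G) ×
    (IndependenceNumber≤ G ⌈ n /2⌉ ⇔ Traceable G) ×
    (IndependenceNumber≤ G ⌈ n /2⌉ ⇔ ArbitrarilyPartitionable G) ×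
    (IndependenceNumber≤ G ⌈ n /2⌉ ⇔ RecursivelyPartitionable G)
proposition12 n 1≤n G class =
  mk⇔ (traceable⇒matching G ∘ α⇒traceable) (matching⇒α≤⌈n/2⌉ G) ,
  mk⇔ α⇒traceable (matching⇒α≤⌈n/2⌉ G ∘ traceable⇒matching G) ,
  mk⇔ (rp⇒ap G ∘ α⇒rp) (ap⇒α≤⌈n/2⌉ G) ,
  mk⇔ α⇒rp (ap⇒α≤⌈n/2⌉ G ∘ rp⇒ap G)
  where
  α⇒traceable : IndependenceNumber≤ G ⌈ n /2⌉ → Traceable G
  α⇒traceable = α≤⌈n/2⌉⇒traceable G class
  α⇒rp : IndependenceNumber≤ G ⌈ n /2⌉ → RecursivelyPartitionable G
  α⇒rp α = traceable⇒rp G (α⇒traceable α) 1≤n
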